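{- For any integer $m\ge 3$, $\xi(K_3\square K_m)=3$.
   Context: All graphs are finite, simple, connected and undirected; $d_G(u,v)$ is the shortest-path distance. A set $D\subseteq V(G)$ is a distance-equalizer set of $G$ if for any two vertices $x,y\in V(G)\setminus D$ there is $w\in D$ with $d_G(x,w)=d_G(y,w)$. The equidistant dimension $\xi(G)$ is the minimum cardinality of a distance-equalizer set of $G$. $K_m$ is the complete graph on $m$ vertices. The Cartesian product $G\square H$ has vertex set $V(G)\times V(H)$, with $(g,h)\sim(g',h')$ iff either $g=g'$ and $hh'\in E(H)$, or $h=h'$ and $gg'\in E(G)$. -}

module Defs where

open import Level using (0ℓ)
open import Data.Nat using (ℕ; zero; suc; _<_; _≥_)
open import Data.Fin using (Fin)
open import Data.Product using (_×_; _,_; ∃; ∃-syntax; Σ-syntax)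
open import Data.Sum using (_⊎_)
open import Data.List using (List; length)
open import Data.List.Membership.Propositional using (_∈_; _∉_)
open import Data.List.Relation.Unary.Unique.Propositional using (Unique)
open import Relation.Binary.PropositionalEquality using (_≡_; _≢_)
open import Relation.Nullary using (¬_)

record Graph : Set₁ where
  field
    Vertex : Set
    _~_    : Vertex → Vertex → Set
open Graph public

K : ℕ → Graph
K m = record { Vertex = Fin m ; _~_ = λ x y → x ≢ y }

_□_ : Graph → Graph → Graph
G □ H = record
  { Vertex = Vertex G × Vertex H
  ; _~_ = λ { (g , h) (g' , h') →
              (g ≡ g' × _~_ H h h') ⊎ (h ≡ h' × _~_ G g g') } }

data Walk (G : Graph) : Vertex G → Vertex G → ℕ → Set where
  here : ∀ {x} → Walk G x x zero
  step : ∀ {x y z k} → _~_ G x y → Walk G y z k → Walk G x z (suc k)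

Dist : (G : Graph) → Vertex G → Vertex G → ℕ → Set
Dist G x y d = Walk G x y d × (∀ k → k < d → ¬ Walk G x y k)

IsDistanceEqualizer : (G : Graph) → List (Vertex G) → Set
IsDistanceEqualizer G D =
  ∀ x y → x ∉ D → y ∉ D →
    ∃[ w ] (w ∈ D × ∃[ d ] (Dist G x w d × Dist G y w d))

EquidistantDimensionIs : Graph → ℕ → Set
EquidistantDimensionIs G n =
  (∃[ D ] (Unique D × IsDistanceEqualizer G D × length D ≡ n))
  × (∀ (D : List (Vertex G)) → Unique D → IsDistanceEqualizer G D → length D ≥ n)

module Submission where

open import Defs
open import Data.Nat using (ℕ; zero; suc; _<_; _≥_; z≤n; s≤s)
open import Data.Nat.Properties using (<-cmp; suc-injective)
open import Data.Fin using (Fin; zero; suc)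
open import Data.Fin.Properties using (_≟_)
open import Data.Product using (_×_; _,_; proj₁; proj₂; ∃-syntax)
open import Data.Sum using (inj₁; inj₂)
open import Data.List using (List; []; _∷_; length; tabulate)
open import Data.List.Membership.Propositional using (_∈_; _∉_)
open import Data.List.Membership.Propositional.Properties using (∈-tabulate⁺)
open import Data.List.Relation.Unary.Any using (here; there)
open import Data.List.Relation.Unary.Unique.Propositional using (Unique)
open import Data.List.Relation.Unary.Unique.Propositional.Properties using (tabulate⁺)
open import Data.List.Relation.Binary.Subset.Propositional using (_⊆_)
open import Data.List.Relation.Binary.Subset.Propositional.Properties using (⊆-refl; xs⊆x∷xs)
open import Relation.Binary using (tri<; tri≈; tri>)
open import Relation.Binary.PropositionalEquality using (_≡_; _≢_; refl; sym; trans; cong)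
open import Relation.Nullary using (¬_; yes; no)
open import Data.Empty using (⊥-elim)
open import Function using (_∘_)

-- Lower bound: whatever two vertices w₁, w₂ are chosen, some vertex is adjacent to both
-- and another is at distance 2 from both, so no set inside {w₁, w₂} equalizes that pair.
-- Upper bound: a column {(i, b)} equalizes any two vertices (a, b₁), (a', b₂) off it
-- through a row i ∉ {a, a'}, which lies at distance 2 from both.

module _ {G : Graph} where

  Walk-zero⇒≡ : ∀ {x y} → Walk G x y 0 → x ≡ y
  Walk-zero⇒≡ here = refl

  Walk-one⇒~ : ∀ {x y} → Walk G x y 1 → _~_ G x y
  Walk-one⇒~ (step x~y here) = x~y

  Dist-functional : ∀ {x y d e} → Dist G x y d → Dist G x y e → d ≡ e
  Dist-functional {d = d} {e} (p , p-min) (q , q-min) with <-cmp d e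
  ... | tri< d<e _ _ = ⊥-elim (q-min d d<e p)
  ... | tri≈ _ d≡e _ = d≡e
  ... | tri> _ _ e<d = ⊥-elim (p-min e e<d q)

  Dist-suc⇒≢ : ∀ {x y d} → Dist G x y (suc d) → x ≢ y
  Dist-suc⇒≢ (_ , minimal) refl = minimal zero (s≤s z≤n) here

  ¬IsDistanceEqualizer : ∀ {D} x y {i j} → i ≢ j →
    (∀ {w} → w ∈ D → Dist G x w (suc i) × Dist G y w (suc j)) →
    ¬ IsDistanceEqualizer G D
  ¬IsDistanceEqualizer x y i≢j far equalizer
    with equalizer x y (λ x∈D → Dist-suc⇒≢ (proj₁ (far x∈D)) refl)
                       (λ y∈D → Dist-suc⇒≢ (proj₂ (far y∈D)) refl)
  ... | w , w∈D , d , x↦w , y↦w =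
    i≢j (suc-injective (trans (Dist-functional (proj₁ (far w∈D)) x↦w)
                              (Dist-functional y↦w (proj₂ (far w∈D)))))

third : ∀ {n} (a b : Fin (suc (suc (suc n)))) → ∃[ c ] (c ≢ a × c ≢ b)
third zero          zero          = suc zero , (λ ()) , (λ ())
third zero          (suc zero)    = suc (suc zero) , (λ ()) , (λ ())
third zero          (suc (suc _)) = suc zero , (λ ()) , (λ ())
third (suc zero)    zero          = suc (suc zero) , (λ ()) , (λ ())
third (suc zero)    (suc _)       = zero , (λ ()) , (λ ())
third (suc (suc _)) zero          = suc zero , (λ ()) , (λ ())
third (suc (suc _)) (suc _)       = zero , (λ ()) , (λ ())

module _ {n m : ℕ} where

  private
    G : Graph
    G = K n □ K m

  Dist-sameRow : ∀ {a b b'} → b ≢ b' → Dist G (a , b) (a , b') 1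
  Dist-sameRow b≢b' = step (inj₁ (refl , b≢b')) here ,
    λ { zero _ p → b≢b' (cong proj₂ (Walk-zero⇒≡ p)) ; (suc _) (s≤s ()) _ }

  Dist-sameColumn : ∀ {a a' b} → a ≢ a' → Dist G (a , b) (a' , b) 1
  Dist-sameColumn a≢a' = step (inj₂ (refl , a≢a')) here ,
    λ { zero _ p → a≢a' (cong proj₁ (Walk-zero⇒≡ p)) ; (suc _) (s≤s ()) _ }

  Dist-distinctCoordinates : ∀ {a a' b b'} → a ≢ a' → b ≢ b' → Dist G (a , b) (a' , b') 2
  Dist-distinctCoordinates {a} {a'} {b} {b'} a≢a' b≢b' =
    step (inj₁ (refl , b≢b')) (step (inj₂ (refl , a≢a')) here) , minimal
    where
    minimal : ∀ k → k < 2 → ¬ Walk G (a , b) (a' , b') k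
    minimal zero _ p = a≢a' (cong proj₁ (Walk-zero⇒≡ p))
    minimal (suc zero) _ p with Walk-one⇒~ p
    ... | inj₁ (a≡a' , _) = a≢a' a≡a'
    ... | inj₂ (b≡b' , _) = b≢b' b≡b'
    minimal (suc (suc _)) (s≤s (s≤s ())) _

module _ {n m : ℕ} where

  private
    G : Graph
    G = K (suc (suc (suc n))) □ K (suc (suc (suc m)))

  commonNeighbour : ∀ w₁ w₂ → ∃[ x ] (Dist G x w₁ 1 × Dist G x w₂ 1)
  commonNeighbour (a , b) (a' , b') with a ≟ a' | b ≟ b'
  ... | yes refl | _ with third b b'
  ...   | c , c≢b , c≢b' = (a , c) , Dist-sameRow c≢b , Dist-sameRow c≢b'
  commonNeighbour (a , b) (a' , b') | no a≢a' | yes refl with third a a'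
  ...   | r , r≢a , r≢a' = (r , b) , Dist-sameColumn r≢a , Dist-sameColumn r≢a'
  commonNeighbour (a , b) (a' , b') | no a≢a' | no b≢b' =
    (a , b') , Dist-sameRow (λ b'≡b → b≢b' (sym b'≡b)) , Dist-sameColumn a≢a'

  commonDistanceTwo : ∀ w₁ w₂ → ∃[ y ] (Dist G y w₁ 2 × Dist G y w₂ 2)
  commonDistanceTwo (a , b) (a' , b') with third a a' | third b b'
  ... | r , r≢a , r≢a' | c , c≢b , c≢b' =
    (r , c) , Dist-distinctCoordinates r≢a c≢b , Dist-distinctCoordinates r≢a' c≢b'

  ¬IsDistanceEqualizer-⊆pair : ∀ w₁ w₂ {D} → D ⊆ w₁ ∷ w₂ ∷ [] → ¬ IsDistanceEqualizer G D
  ¬IsDistanceEqualizer-⊆pair w₁ w₂ D⊆w₁w₂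
    with commonNeighbour w₁ w₂ | commonDistanceTwo w₁ w₂
  ... | x , x↦w₁ , x↦w₂ | y , y↦w₁ , y↦w₂ = ¬IsDistanceEqualizer x y (λ ()) far
    where
    far : ∀ {w} → w ∈ _ → Dist G x w 1 × Dist G y w 2
    far w∈D with D⊆w₁w₂ w∈D
    ... | here refl = x↦w₁ , y↦w₁
    ... | there (here refl) = x↦w₂ , y↦w₂

  IsDistanceEqualizer⇒length≥3 : ∀ D → IsDistanceEqualizer G D → length D ≥ 3
  IsDistanceEqualizer⇒length≥3 [] =
    ⊥-elim ∘ ¬IsDistanceEqualizer-⊆pair (zero , zero) (zero , zero) (λ ())
  IsDistanceEqualizer⇒length≥3 (w ∷ []) =
    ⊥-elim ∘ ¬IsDistanceEqualizer-⊆pair w w (xs⊆x∷xs (w ∷ []) w)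
  IsDistanceEqualizer⇒length≥3 (w₁ ∷ w₂ ∷ []) = ⊥-elim ∘ ¬IsDistanceEqualizer-⊆pair w₁ w₂ ⊆-refl
  IsDistanceEqualizer⇒length≥3 (_ ∷ _ ∷ _ ∷ _) _ = s≤s (s≤s (s≤s z≤n))

column : ∀ {k m} → Fin m → List (Fin k × Fin m)
column b = tabulate (_, b)

∈-column : ∀ {k m} (a : Fin k) (b : Fin m) → (a , b) ∈ column b
∈-column a b = ∈-tabulate⁺ {f = _, b} a

column-unique : ∀ {k m} (b : Fin m) → Unique (column {k} b)
column-unique b = tabulate⁺ (cong proj₁)

column-isDistanceEqualizer : ∀ {n m} (b : Fin m) →
  IsDistanceEqualizer (K (suc (suc (suc n))) □ K m) (column b)
column-isDistanceEqualizer b (a , b₁) (a' , b₂) x∉column y∉column with third a a'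
... | i , i≢a , i≢a' =
  (i , b) , ∈-column i b , 2 ,
  Dist-distinctCoordinates (i≢a ∘ sym) (off-column x∉column) ,
  Dist-distinctCoordinates (i≢a' ∘ sym) (off-column y∉column)
  where
  off-column : ∀ {a b'} → (a , b') ∉ column b → b' ≢ b
  off-column {a} ∉column refl = ∉column (∈-column a b)

mainTheorem6 : ∀ (m : ℕ) → m ≥ 3 → EquidistantDimensionIs (K 3 □ K m) 3
mainTheorem6 (suc (suc (suc _))) (s≤s (s≤s (s≤s _))) =
  (column zero , column-unique zero , column-isDistanceEqualizer zero , refl) ,
  λ D _ → IsDistanceEqualizer⇒length≥3 D
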